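{- Let $\boldsymbol{\Sigma}$ be a set of sequents and $\Sigma$ a sequent. Then $\Sigma$ is derivable from $\boldsymbol{\Sigma}$ in $\mathrm{NMVL}_R$ if and only if $\Sigma$ is derivable from $\boldsymbol{\Sigma}$ in $\mathrm{NMVL}_A$.
   Context: Fix a propositional language with a set of connectives, each connective $\ast$ having an arity $\ell$, and let $\mathcal{F}$ be its set of formulas. Fix truth values $V=\{v_1,\ldots,v_n\}$, $n\ge 2$. Each $\ell$-ary connective $\ast$ is given a non-deterministic truth table $\ast: V^\ell \to P(V)\setminus\{\emptyset\}$. A labelled formula is a pair $(\varphi,k)$ with $\varphi\in\mathcal{F}$, $k\in\{1,\ldots,n\}$. A sequent is $\Gamma\rightarrow\Delta$ with $\Gamma,\Delta$ finite (possibly empty) sets of labelled formulas; commas denote union. For $K\subseteq\{1,\dots,n\}$, $\overline{K}=\{1,\ldots,n\}\setminus K$ and $\{\varphi\}\times K=\{(\varphi,k):k\in K\}$. Structural rules (common to both calculi), for all finite sets $\Gamma,\Delta,\Delta',\Delta''$ of labelled formulas and formulas $\varphi$: - $k$-L-shift: from $\Gamma,(\varphi,k)\rightarrow\Delta$ infer $\Gamma\rightarrow\Delta,\{\varphi\}\times\overline{\{k\}}$; - $k',k''$-R-shift ($k'\ne k''$): from $\Gamma\rightarrow\Delta,(\varphi,k')$ infer $\Gamma,(\varphi,k'')\rightarrow\Delta$; - $k$-L-weakening: from $\Gamma\rightarrow\Delta$ infer $\Gamma,(\varphi,k)\rightarrow\Delta$; - $k$-R-weakening: from $\Gamma\rightarrow\Delta$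 infer $\Gamma\rightarrow\Delta,(\varphi,k)$; - $k$-cut: from $\Gamma\rightarrow\Delta,(\varphi,k)$ and $\Gamma,(\varphi,k)\rightarrow\Delta$ infer $\Gamma\rightarrow\Delta$; - $k',k''$-resolution ($k'\neq k''$): from $\Gamma\rightarrow\Delta',(\varphi,k')$ and $\Gamma\rightarrow\Delta'',(\varphi,k'')$ infer $\Gamma\rightarrow\Delta',\Delta''$. Both calculi have the axioms $(\psi,k)\rightarrow(\psi,k)$ for every formula $\psi$ and $k=1,\ldots,n$. $\mathrm{NMVL}_A$ additionally has the table axioms: for every connective $\ast$ of arity $\ell$, formulas $\varphi_1,\ldots,\varphi_\ell$ and $k_1,\ldots,k_\ell\in\{1,\dots,n\}$, the sequent $(\varphi_1,k_1),\ldots,(\varphi_\ell,k_\ell)\rightarrow\{(\ast(\varphi_1,\ldots,\varphi_\ell),k): v_k\in\ast(v_{k_1},\ldots,v_{k_\ell})\}$. $\mathrm{NMVL}_R$ instead (no table axioms) has, for every such $\ast,\varphi_1,\ldots,\varphi_\ell,k_1,\ldots,k_\ell$ and all finite $\Gamma,\Delta$, the rule: from the $\ell$ premises $\Gamma\rightarrow\Delta,(\varphi_j,k_j)$, $j=1,\ldots,\ell$, infer $\Gamma\rightarrow\Delta,\{(\ast(\varphi_1,\ldots,\varphi_\ell),k): v_k\in\ast(v_{k_1},\ldots,v_{k_\ell})\}$. A sequent is derivable from a set of sequents $\boldsymbol{\Sigma}$ in a calculus if it has a derivation in that calculus using its axioms, the members of $\boldsymbol{\Sigma}$ as additional initial sequents,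 and its rules. -}

module Defs where

open import Data.Nat using (ℕ)
open import Data.Fin using (Fin; _≟_)
open import Data.Fin.Subset using (Subset; _∈_)
open import Data.Fin.Subset.Properties using (_∈?_)
open import Data.List using (List; []; _∷_; _++_; [_]; map; filter; allFin)
open import Data.List.Relation.Binary.BagAndSetEquality using (_∼[_]_; set)
open import Data.Vec using (Vec; lookup; zipWith; toList)
open import Data.Product using (_×_; _,_)
open import Relation.Nullary using (¬_; ¬?)
open import Relation.Binary.PropositionalEquality using (_≡_)

data Formula {C : Set} (arity : C → ℕ) : Set where
  var : ℕ → Formula arity
  app : (c : C) → Vec (Formula arity) (arity c) → Formula arity

data Calc : Set where
  NMVL-A NMVL-R : Calc

module NMVL {C : Set} (arity : C → ℕ) (n : ℕ)
            (table : (c : C) → Vec (Fin n) (arity c) → Subset n) where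

  -- truth value v_k is represented by k : Fin n
  LFormula : Set
  LFormula = Formula arity × Fin n

  -- A finite set of labelled formulas is represented by a list; lists with
  -- the same members represent the same set (see the rule `conv`).
  record Sequent : Set where
    constructor _⇒_
    field
      ante : List LFormula
      succ : List LFormula

  others : Formula arity → Fin n → List LFormula
  others φ k = map (φ ,_) (filter (λ j → ¬? (j ≟ k)) (allFin n))

  tableSet : (c : C) → Vec (Formula arity) (arity c) → Vec (Fin n) (arity c) → List LFormula
  tableSet c φs ks = map (λ k → (app c φs , k)) (filter (λ k → k ∈? table c ks) (allFin n))

  args : ∀ {ℓ} → Vec (Formula arity) ℓ → Vec (Fin n) ℓ → List LFormula
  args φs ks = toList (zipWith _,_ φs ks)

  data Derivable (Σ : Sequent → Set) : Calc → Sequent → Set where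
    conv : ∀ {cl Γ Δ Γ' Δ'} → Γ ∼[ set ] Γ' → Δ ∼[ set ] Δ' →
           Derivable Σ cl (Γ ⇒ Δ) → Derivable Σ cl (Γ' ⇒ Δ')
    hyp  : ∀ {cl S} → Σ S → Derivable Σ cl S
    ax   : ∀ {cl} (ψ : Formula arity) (k : Fin n) →
           Derivable Σ cl ([ (ψ , k) ] ⇒ [ (ψ , k) ])
    L-shift : ∀ {cl Γ Δ φ k} → Derivable Σ cl (((φ , k) ∷ Γ) ⇒ Δ) →
              Derivable Σ cl (Γ ⇒ (Δ ++ others φ k))
    R-shift : ∀ {cl Γ Δ φ k' k''} → ¬ (k' ≡ k'') →
              Derivable Σ cl (Γ ⇒ ((φ , k') ∷ Δ)) →
              Derivable Σ cl (((φ , k'') ∷ Γ) ⇒ Δ)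
    L-weak : ∀ {cl Γ Δ} φ k → Derivable Σ cl (Γ ⇒ Δ) →
             Derivable Σ cl (((φ , k) ∷ Γ) ⇒ Δ)
    R-weak : ∀ {cl Γ Δ} φ k → Derivable Σ cl (Γ ⇒ Δ) →
             Derivable Σ cl (Γ ⇒ ((φ , k) ∷ Δ))
    cut : ∀ {cl Γ Δ φ k} → Derivable Σ cl (Γ ⇒ ((φ , k) ∷ Δ)) →
          Derivable Σ cl (((φ , k) ∷ Γ) ⇒ Δ) → Derivable Σ cl (Γ ⇒ Δ)
    resolution : ∀ {cl Γ Δ' Δ'' φ k' k''} → ¬ (k' ≡ k'') →
                 Derivable Σ cl (Γ ⇒ ((φ , k') ∷ Δ')) →
                 Derivable Σ cl (Γ ⇒ ((φ , k'') ∷ Δ'')) →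
                 Derivable Σ cl (Γ ⇒ (Δ' ++ Δ''))
    table-ax : (c : C) (φs : Vec (Formula arity) (arity c)) (ks : Vec (Fin n) (arity c)) →
               Derivable Σ NMVL-A (args φs ks ⇒ tableSet c φs ks)
    table-rule : ∀ {Γ Δ} (c : C) (φs : Vec (Formula arity) (arity c)) (ks : Vec (Fin n) (arity c)) →
                 ((j : Fin (arity c)) → Derivable Σ NMVL-R (Γ ⇒ ((lookup φs j , lookup ks j) ∷ Δ))) →
                 Derivable Σ NMVL-R (Γ ⇒ (Δ ++ tableSet c φs ks))

{-# OPTIONS --safe #-}
-- The two calculi share all structural rules, so it suffices to derive the
-- table principle of each calculus in the other one.  The table axiom is the
-- table rule applied to identity axioms (Γ = {(φⱼ,kⱼ)}, Δ = ∅); conversely the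
-- conclusion of a table rule follows from the weakened table axiom by cutting
-- the labelled arguments (φⱼ,kⱼ) one at a time against the weakened premises.
module Submission where

open import Defs
open import Data.Nat using (ℕ; _≤_)
open import Data.Fin using (Fin; zero; suc)
open import Data.Fin.Subset using (Subset; Nonempty)
open import Data.List using (List; []; _∷_; _++_; [_])
open import Data.List.Membership.Propositional using (_∈_)
open import Data.List.Membership.Propositional.Properties using (∈-++⁺ˡ; ∈-++⁻)
open import Data.List.Relation.Unary.Any using (here)
open import Data.List.Relation.Binary.BagAndSetEquality
  using (_∼[_]_; set; commutativeMonoid)
open import Data.Vec using (Vec; lookup; zipWith)
open import Data.Vec.Properties using (lookup-zipWith)
open import Data.Vec.Membership.Propositional.Properties using (∈-lookup; ∈-toList⁺)
open import Data.Product using (_,_)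
open import Data.Sum using ([_,_]′)
open import Algebra.Bundles using (CommutativeMonoid)
open import Function using (id)
open import Function.Bundles using (_⇔_; mk⇔)
open import Function.Related.Propositional using (equivalence)
open import Relation.Binary.PropositionalEquality using (refl; subst)

++-absorbʳ : ∀ {A : Set} {x : A} {xs : List A} → x ∈ xs → xs ++ [ x ] ∼[ set ] xs
++-absorbʳ {xs = xs} x∈xs =
  mk⇔ (λ p → [ id , (λ { (here refl) → x∈xs }) ]′ (∈-++⁻ xs p)) ∈-++⁺ˡ

module Translation {C : Set} (arity : C → ℕ) (n : ℕ)
                   (table : (c : C) → Vec (Fin n) (arity c) → Subset n)
                   (Σ : NMVL.Sequent arity n table → Set) where
  open NMVL arity n table
  open CommutativeMonoid (commutativeMonoid equivalence LFormula)
    using () renaming (refl to ∼-refl; comm to ++-comm)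

  lookup-∈-args : ∀ {ℓ} (φs : Vec (Formula arity) ℓ) (ks : Vec (Fin n) ℓ) (j : Fin ℓ) →
                  (lookup φs j , lookup ks j) ∈ args φs ks
  lookup-∈-args φs ks j =
    subst (_∈ args φs ks) (lookup-zipWith _,_ j φs ks) (∈-toList⁺ (∈-lookup j (zipWith _,_ φs ks)))

  weakenˡ-++ : ∀ {cl Γ Δ} (Θ : List LFormula) →
               Derivable Σ cl (Γ ⇒ Δ) → Derivable Σ cl ((Θ ++ Γ) ⇒ Δ)
  weakenˡ-++ []            d = d
  weakenˡ-++ ((φ , k) ∷ Θ) d = L-weak φ k (weakenˡ-++ Θ d)

  weakenʳ-++ : ∀ {cl Γ Δ} (Θ : List LFormula) →
               Derivable Σ cl (Γ ⇒ Δ) → Derivable Σ cl (Γ ⇒ (Θ ++ Δ))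
  weakenʳ-++ []            d = d
  weakenʳ-++ ((φ , k) ∷ Θ) d = R-weak φ k (weakenʳ-++ Θ d)

  weakenʳ-++ʳ : ∀ {cl Γ Δ} (Θ : List LFormula) →
                Derivable Σ cl (Γ ⇒ Δ) → Derivable Σ cl (Γ ⇒ (Δ ++ Θ))
  weakenʳ-++ʳ {Δ = Δ} Θ d = conv ∼-refl (++-comm Θ Δ) (weakenʳ-++ Θ d)

  cut-args : ∀ {cl ℓ Γ Δ} (φs : Vec (Formula arity) ℓ) (ks : Vec (Fin n) ℓ) →
             ((j : Fin ℓ) → Derivable Σ cl (Γ ⇒ ((lookup φs j , lookup ks j) ∷ Δ))) →
             Derivable Σ cl ((args φs ks ++ Γ) ⇒ Δ) → Derivable Σ cl (Γ ⇒ Δ)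
  cut-args Vec.[]         Vec.[]         prem d = d
  cut-args (φ Vec.∷ φs) (k Vec.∷ ks) prem d =
    cut-args φs ks (λ j → prem (suc j)) (cut (weakenˡ-++ (args φs ks) (prem zero)) d)

  table-rule-A : ∀ {Γ Δ} (c : C) (φs : Vec (Formula arity) (arity c)) (ks : Vec (Fin n) (arity c)) →
                 ((j : Fin (arity c)) → Derivable Σ NMVL-A (Γ ⇒ ((lookup φs j , lookup ks j) ∷ Δ))) →
                 Derivable Σ NMVL-A (Γ ⇒ (Δ ++ tableSet c φs ks))
  table-rule-A {Γ} {Δ} c φs ks prem =
    cut-args φs ks (λ j → weakenʳ-++ʳ (tableSet c φs ks) (prem j))
      (conv (++-comm Γ (args φs ks)) ∼-refl (weakenˡ-++ Γ (weakenʳ-++ Δ (table-ax c φs ks))))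

  table-ax-R : (c : C) (φs : Vec (Formula arity) (arity c)) (ks : Vec (Fin n) (arity c)) →
               Derivable Σ NMVL-R (args φs ks ⇒ tableSet c φs ks)
  table-ax-R c φs ks = table-rule {Δ = []} c φs ks λ j →
    conv (++-absorbʳ (lookup-∈-args φs ks j)) ∼-refl
         (weakenˡ-++ (args φs ks) (ax (lookup φs j) (lookup ks j)))

  R⇒A : ∀ {S} → Derivable Σ NMVL-R S → Derivable Σ NMVL-A S
  R⇒A (conv p q d)             = conv p q (R⇒A d)
  R⇒A (hyp s)                  = hyp s
  R⇒A (ax ψ k)                 = ax ψ k
  R⇒A (L-shift d)              = L-shift (R⇒A d)
  R⇒A (R-shift k'≢k'' d)       = R-shift k'≢k'' (R⇒A d)
  R⇒A (L-weak φ k d)           = L-weak φ k (R⇒A d)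
  R⇒A (R-weak φ k d)           = R-weak φ k (R⇒A d)
  R⇒A (cut d e)                = cut (R⇒A d) (R⇒A e)
  R⇒A (resolution k'≢k'' d e)  = resolution k'≢k'' (R⇒A d) (R⇒A e)
  R⇒A (table-rule c φs ks prem) = table-rule-A c φs ks (λ j → R⇒A (prem j))

  A⇒R : ∀ {S} → Derivable Σ NMVL-A S → Derivable Σ NMVL-R S
  A⇒R (conv p q d)             = conv p q (A⇒R d)
  A⇒R (hyp s)                  = hyp s
  A⇒R (ax ψ k)                 = ax ψ k
  A⇒R (L-shift d)              = L-shift (A⇒R d)
  A⇒R (R-shift k'≢k'' d)       = R-shift k'≢k'' (A⇒R d)
  A⇒R (L-weak φ k d)           = L-weak φ k (A⇒R d)
  A⇒R (R-weak φ k d)           = R-weak φ k (A⇒R d)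
  A⇒R (cut d e)                = cut (A⇒R d) (A⇒R e)
  A⇒R (resolution k'≢k'' d e)  = resolution k'≢k'' (A⇒R d) (A⇒R e)
  A⇒R (table-ax c φs ks)       = table-ax-R c φs ks

proposition2 : {C : Set} (arity : C → ℕ) (n : ℕ) → 2 ≤ n →
    (table : (c : C) → Vec (Fin n) (arity c) → Subset n) →
    (∀ c ks → Nonempty (table c ks)) →
    (Σ : NMVL.Sequent arity n table → Set) (S : NMVL.Sequent arity n table) →
    NMVL.Derivable arity n table Σ NMVL-R S ⇔ NMVL.Derivable arity n table Σ NMVL-A S
proposition2 arity n _ table _ Σ _ = mk⇔ R⇒A A⇒R
  where open Translation arity n table Σ
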